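{- There exists a one-sided error non-adaptive tester for $k$-monotonicity of functions $f\colon[n]\to\{0,1\}$ with query complexity $q(n,\varepsilon,k)=O(k/\varepsilon)$.
   Context: $[n]=\{1,\dots,n\}$ with its usual order. A function $f\colon[n]\to\{0,1\}$ is $k$-monotone if there are no $x_1\le\cdots\le x_{k+1}$ with $f(x_1)=1$ and $f(x_i)\ne f(x_{i+1})$ for all $i\in[k]$. Distance is normalized Hamming distance under the uniform distribution; $\varepsilon$-far means distance at least $\varepsilon$ to every $k$-monotone function. A tester, given $\varepsilon$ and query access to $f$, accepts $k$-monotone $f$ with probability at least $2/3$ and rejects $\varepsilon$-far $f$ with probability at least $2/3$; one-sided means $k$-monotone functions are always accepted; non-adaptive means queries do not depend on previous answers.
   Formalization: The parameter ε ranges only over the positive rationals. -}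

module Defs where

open import Data.Nat as ℕ using (ℕ; zero; suc)
open import Data.Bool using (Bool; true; false)
open import Data.Fin using (Fin; zero; suc; inject₁)
open import Data.Fin as F using ()
open import Data.Product using (Σ; _×_; ∃-syntax)
open import Data.Integer using (+_)
open import Data.Rational as ℚ using (ℚ; _/_)
open import Relation.Nullary using (¬_)
open import Relation.Binary.PropositionalEquality using (_≡_; _≢_)

count : {m : ℕ} → (Fin m → Bool) → ℕ
count {zero}  p = 0
count {suc m} p with p zero
... | true  = suc (count (λ i → p (suc i)))
... | false = count (λ i → p (suc i))

_≠ᵇ_ : Bool → Bool → Bool
true  ≠ᵇ true  = false
false ≠ᵇ false = false
_     ≠ᵇ _     = true

-- functions f : [n] → {0,1}, with [n] = Fin n (order of Fin), 1 = true
BoolFun : ℕ → Set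
BoolFun n = Fin n → Bool

-- a witness of non-k-monotonicity: x₁ ≤ … ≤ x_{k+1} (indexed by Fin (suc k)),
-- f(x₁) = 1 and f(xᵢ) ≠ f(xᵢ₊₁) for all i ∈ [k]
Violation : (k : ℕ) {n : ℕ} → BoolFun n → Set
Violation k {n} f =
  Σ (Fin (suc k) → Fin n) λ x →
    ((i : Fin k) → x (inject₁ i) F.≤ x (suc i))
    × (f (x zero) ≡ true)
    × ((i : Fin k) → f (x (inject₁ i)) ≢ f (x (suc i)))

KMonotone : (k : ℕ) {n : ℕ} → BoolFun n → Set
KMonotone k f = ¬ Violation k f

-- Hamming distance count |{x : f x ≠ g x}| (normalized distance = this / n)
hamming : {n : ℕ} → BoolFun n → BoolFun n → ℕ
hamming f g = count (λ x → f x ≠ᵇ g x)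

ℕ→ℚ : ℕ → ℚ
ℕ→ℚ m = + m / 1

-- f is ε-far from k-monotone: dist(f,g) = hamming f g / n ≥ ε for every
-- k-monotone g (stated multiplied by n)
Far : (k : ℕ) {n : ℕ} → ℚ → BoolFun n → Set
Far k {n} ε f = (g : BoolFun n) → KMonotone k g → ε ℚ.* ℕ→ℚ n ℚ.≤ ℕ→ℚ (hamming f g)

-- Its randomness is a uniformly random seed s ∈ Fin seeds (seeds ≥ 1);
-- the query points depend only on the seed (non-adaptivity), and the
-- accept/reject decision (true = accept) depends on the seed and the
-- answers to the queries.
record NATester (n q : ℕ) : Set where
  field
    seeds   : ℕ
    seeds>0 : 0 ℕ.< seeds
    query   : Fin seeds → Fin q → Fin n
    decide  : Fin seeds → (Fin q → Bool) → Bool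

  accepts : BoolFun n → ℕ
  accepts f = count (λ s → decide s (λ j → f (query s j)))

open NATester public

-- one-sided error tester for k-monotonicity with proximity parameter ε:
-- every k-monotone f is accepted with probability 1, and every ε-far f
-- is rejected with probability ≥ 2/3 (accepted with probability ≤ 1/3)
OneSidedKMonoTester : (k n q : ℕ) → ℚ → NATester n q → Set
OneSidedKMonoTester k n q ε T =
  ((f : BoolFun n) → KMonotone k f → accepts T f ≡ seeds T)
  × ((f : BoolFun n) → Far k ε f → 3 ℕ.* accepts T f ℕ.≤ seeds T)

module Submission where

-- The tester samples every point of [n] independently with probability p = P/(P + E) and
-- rejects iff a greedy left-to-right scan of the sample finds an alternating subsequence
-- 1, 0, 1, … of length k + 1; a k-monotone function has none and is always accepted.
-- When the scan fails, the alternation level it has reached after each point defines a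
-- k-monotone function which differs from f only at misses: points whose value the scan was
-- waiting for but which were not sampled. Each waiting point is sampled with probability p,
-- so P·𝔼[misses] = E·𝔼[hits] ≤ E(k + 1). For ε = a/b and an ε-far f every failed scan has at
-- least an/b misses, so with E = an and P = 6(k + 1)b the scan fails with probability ≤ 1/6.
-- The sample has expected size ≤ P/a = 6(k + 1)/ε, so by Markov's inequality it exceeds
-- q = 36(k + 1)/ε with probability ≤ 1/6, and only then is f accepted without a scan.
-- Probabilities are counts over the seeds σ : [n] → Fin (P + E), where x is sampled iff σ x < P.

open import Defs

-- A separate module, because the statement below uses ℚ's _*_, _<_ and _≤_ unqualified.
module KMonotonicityTesting where
  open import Data.Bool as Bool using (Bool; true; false; not; _∧_; if_then_else_)
  open import Data.Bool.Properties using (not-involutive; not-¬; ¬-not)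
  open import Data.Empty using (⊥-elim)
  open import Data.Maybe as Maybe using (Maybe; just; nothing; fromMaybe)
  open import Data.Sum using (_⊎_; inj₁; inj₂; [_,_]′)
  open import Data.Fin as F using (Fin; zero; suc; toℕ; inject₁; fromℕ; fromℕ<; _↑ˡ_; _↑ʳ_; combine; remQuot)
  open import Data.Fin.Properties using (toℕ-inject₁; toℕ-fromℕ; toℕ-fromℕ<; ≤̄⇒inject₁<; remQuot-combine)
  open import Data.Fin.Induction using (<-weakInduction)
  open import Data.Nat as ℕ using (ℕ; zero; suc; _+_; _*_; _∸_; _^_; _≤_; _<_; z≤n; s≤s; _<?_)
  open import Data.Nat.Properties
  open import Data.Product using (Σ; _×_; _,_; proj₁; proj₂)
  open import Function using (_∘_)
  open import Function.Bundles using (_⇔_; mk⇔; module Equivalence)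
  open import Data.Nat.Coprimality using (Coprime)
  open import Data.Nat.DivMod using (_/_; _%_; m≡m%n+[m/n]*n; m%n<n; m/n*n≤m)
  open import Data.Integer as ℤ using ()
  open import Data.Integer.Properties as ℤ using ()
  open import Data.Rational as ℚ using (ℚ; mkℚ; toℚᵘ; 0ℚ)
  open import Data.Rational.Properties as ℚ
    using (toℚᵘ-mono-≤; toℚᵘ-cancel-≤; toℚᵘ-homo-*; toℚᵘ-fromℚᵘ)
  open import Data.Rational.Unnormalised as ℚᵘ using (mkℚᵘ)
  open import Data.Rational.Unnormalised.Properties as ℚᵘ using ()
  open import Relation.Nullary using (Dec; yes; no; does; proof; ofʸ; _×-dec_; contradiction)
  open import Relation.Nullary.Decidable using (dec-true)
  open import Algebra.Properties.CommutativeSemigroup *-commutativeSemigroup using (x∙yz≈y∙xz)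
  open import Relation.Binary.Core using (_Preserves_⟶_)
  open import Relation.Binary.PropositionalEquality
  open import Data.Vec.Functional using (Vector; []; _∷_)
  open import Algebra.Properties.CommutativeMonoid.Sum +-0-commutativeMonoid
    using (sum; sum-syntax; ∑-distrib-+; sum-cong-≗)
  open import Algebra.Properties.Semiring.Sum +-*-semiring using (*-distribˡ-sum)
  open import Data.Nat.Tactic.RingSolver using (solve-∀)

  𝟙 : Bool → ℕ
  𝟙 true  = 1
  𝟙 false = 0

  𝟙≤1 : ∀ b → 𝟙 b ≤ 1
  𝟙≤1 true  = ≤-refl
  𝟙≤1 false = z≤n

  ≠ᵇ-refl : ∀ v → (v ≠ᵇ v) ≡ false
  ≠ᵇ-refl true  = refl
  ≠ᵇ-refl false = refl

  𝟙≤𝟙+𝟙 : ∀ {A B : Set} b (a? : Dec A) (b? : Dec B) → (b ≡ true → A ⊎ B) →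
    𝟙 b ≤ 𝟙 (does a?) + 𝟙 (does b?)
  𝟙≤𝟙+𝟙 false _      _       _   = z≤n
  𝟙≤𝟙+𝟙 true  (yes _) _       _   = s≤s z≤n
  𝟙≤𝟙+𝟙 true  (no _)  (yes _) _   = ≤-refl
  𝟙≤𝟙+𝟙 true  (no ¬a) (no ¬b) a⊎b = ⊥-elim ([ ¬a , ¬b ]′ (a⊎b refl))

  count-suc : ∀ {m} (p : Fin (suc m) → Bool) → count p ≡ 𝟙 (p zero) + count (p ∘ suc)
  count-suc p with p zero
  ... | true  = refl
  ... | false = refl

  alternating : ℕ → Bool
  alternating zero    = true
  alternating (suc j) = not (alternating j)

  record AlternatingChain (j r : ℕ) {n : ℕ} (f : BoolFun n) : Set where
    constructor chain
    field
      point      : Fin r → Fin n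
      point-mono : point Preserves F._≤_ ⟶ F._≤_
      value      : ∀ i → f (point i) ≡ alternating (j + toℕ i)

  AlternatingChain-suc : ∀ {j r n} {f : BoolFun (suc n)} → AlternatingChain j r (f ∘ suc) → AlternatingChain j r f
  AlternatingChain-suc (chain y y-mono f∘y) = chain (suc ∘ y) (s≤s ∘ y-mono) f∘y

  -- In state j < K the scan waits for the value alternating j; a point with that value is a
  -- hit if S selects it (the state advances to j + 1) and a miss otherwise.
  module Greedy (K : ℕ) where

    Active : ℕ → Bool → Set
    Active j v = j < K × v ≡ alternating j

    -- Opaque, so that `with active? j v` abstracts it in goals mentioning step.
    opaque
      active? : ∀ j v → Dec (Active j v)
      active? j v = j <? K ×-dec v Bool.≟ alternating j

    step : ℕ → Bool → Bool → ℕ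
    step j v s = if does (active? j v) ∧ s then suc j else j

    finalState : ℕ → ∀ {n} → BoolFun n → BoolFun n → ℕ
    finalState j {zero}  f S = j
    finalState j {suc n} f S = finalState (step j (f zero) (S zero)) (f ∘ suc) (S ∘ suc)

    stateAfter : ℕ → ∀ {n} → BoolFun n → BoolFun n → Fin n → ℕ
    stateAfter j {suc n} f S zero    = step j (f zero) (S zero)
    stateAfter j {suc n} f S (suc x) = stateAfter (step j (f zero) (S zero)) (f ∘ suc) (S ∘ suc) x

    misses : ℕ → ∀ {n} → BoolFun n → BoolFun n → ℕ
    misses j {zero}  f S = 0
    misses j {suc n} f S =
      𝟙 (does (active? j (f zero)) ∧ not (S zero)) + misses (step j (f zero) (S zero)) (f ∘ suc) (S ∘ suc)

    hits : ℕ → ∀ {n} → BoolFun n → BoolFun n → ℕ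
    hits j {zero}  f S = 0
    hits j {suc n} f S =
      𝟙 (does (active? j (f zero)) ∧ S zero) + hits (step j (f zero) (S zero)) (f ∘ suc) (S ∘ suc)

    rounded : ℕ → ∀ {n} → BoolFun n → BoolFun n → BoolFun n
    rounded j f S x = not (alternating (stateAfter j f S x))

    step-≥ : ∀ j v s → j ≤ step j v s
    step-≥ j v s with does (active? j v) ∧ s
    ... | true  = n≤1+n j
    ... | false = ≤-refl

    finalState-≥ : ∀ j {n} (f S : BoolFun n) → j ≤ finalState j f S
    finalState-≥ j {zero}  f S = ≤-refl
    finalState-≥ j {suc n} f S = ≤-trans (step-≥ j (f zero) (S zero)) (finalState-≥ _ (f ∘ suc) (S ∘ suc))

    stateAfter-≥ : ∀ j {n} (f S : BoolFun n) x → j ≤ stateAfter j f S x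
    stateAfter-≥ j {suc n} f S zero    = step-≥ j (f zero) (S zero)
    stateAfter-≥ j {suc n} f S (suc x) =
      ≤-trans (step-≥ j (f zero) (S zero)) (stateAfter-≥ _ (f ∘ suc) (S ∘ suc) x)

    stateAfter≤finalState : ∀ j {n} (f S : BoolFun n) x → stateAfter j f S x ≤ finalState j f S
    stateAfter≤finalState j {suc n} f S zero    = finalState-≥ _ (f ∘ suc) (S ∘ suc)
    stateAfter≤finalState j {suc n} f S (suc x) = stateAfter≤finalState _ (f ∘ suc) (S ∘ suc) x

    stateAfter-mono : ∀ j {n} (f S : BoolFun n) {x y} → x F.≤ y → stateAfter j f S x ≤ stateAfter j f S y
    stateAfter-mono j {suc n} f S {zero}  {zero}  _         = ≤-refl
    stateAfter-mono j {suc n} f S {zero}  {suc y} _         = stateAfter-≥ _ (f ∘ suc) (S ∘ suc) y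
    stateAfter-mono j {suc n} f S {suc x} {suc y} (s≤s x≤y) = stateAfter-mono _ (f ∘ suc) (S ∘ suc) x≤y

    disagreement≤miss : ∀ j v s → j < K →
      𝟙 (v ≠ᵇ not (alternating (step j v s))) ≤ 𝟙 (does (active? j v) ∧ not s)
    disagreement≤miss j v s j<K with active? j v | s
    ... | yes (_ , refl) | true  rewrite not-involutive (alternating j) | ≠ᵇ-refl (alternating j) = z≤n
    ... | yes _          | false = 𝟙≤1 _
    ... | no ¬active     | _
      rewrite ¬-not (λ v≡ → ¬active (j<K , v≡)) | ≠ᵇ-refl (not (alternating j)) = z≤n

    hamming-rounded≤misses : ∀ j {n} (f S : BoolFun n) → finalState j f S < K →
      hamming f (rounded j f S) ≤ misses j f S
    hamming-rounded≤misses j {zero}  f S _ = z≤n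
    hamming-rounded≤misses j {suc n} f S final<K
      rewrite count-suc (λ x → f x ≠ᵇ rounded j f S x) =
      +-mono-≤ (disagreement≤miss j (f zero) (S zero) (≤-<-trans (finalState-≥ j f S) final<K))
               (hamming-rounded≤misses _ (f ∘ suc) (S ∘ suc) final<K)

    hits≤ : ∀ j {n} (f S : BoolFun n) → hits j f S ≤ K ∸ j
    hits≤ j {zero}  f S = z≤n
    hits≤ j {suc n} f S with active? j (f zero) | S zero
    ... | yes (j<K , _) | true  =
      ≤-trans (s≤s (hits≤ (suc j) (f ∘ suc) (S ∘ suc))) (≤-reflexive (sym (+-∸-assoc 1 j<K)))
    ... | yes _         | false = hits≤ j (f ∘ suc) (S ∘ suc)
    ... | no _          | _     = hits≤ j (f ∘ suc) (S ∘ suc)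

    step-unselected : ∀ j v → step j v false ≡ j
    step-unselected j v with does (active? j v)
    ... | true  = refl
    ... | false = refl

    finalState-cong : ∀ j {n} {f g : BoolFun n} (S : BoolFun n) → (∀ x → S x ≡ true → f x ≡ g x) →
      finalState j f S ≡ finalState j g S
    finalState-cong j {zero}  S f≡g = refl
    finalState-cong j {suc n} {f} {g} S f≡g with S zero in S₀
    ... | true  rewrite f≡g zero S₀ = finalState-cong _ (S ∘ suc) (f≡g ∘ suc)
    ... | false rewrite step-unselected j (f zero) | step-unselected j (g zero) =
      finalState-cong j (S ∘ suc) (f≡g ∘ suc)

    hitChain : ∀ j r {n} (f S : BoolFun n) → j + r ≤ finalState j f S → AlternatingChain j r f
    hitChain j zero    f S _ = chain [] (λ {}) (λ ())
    hitChain j (suc r) {zero} f S j+r<j = ⊥-elim (m+1+n≰m j j+r<j)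
    hitChain j (suc r) {suc n} f S j+r<final with active? j (f zero) | S zero
    ... | yes (_ , f₀≡) | true = chain (zero ∷ (suc ∘ point)) y-mono f∘y
      where
        open AlternatingChain (hitChain (suc j) r (f ∘ suc) (S ∘ suc)
          (subst (_≤ finalState (suc j) (f ∘ suc) (S ∘ suc)) (+-suc j r) j+r<final))
        y-mono : (zero ∷ (suc ∘ point)) Preserves F._≤_ ⟶ F._≤_
        y-mono {zero}  {_}      _          = z≤n
        y-mono {suc i} {suc i′} (s≤s i≤i′) = s≤s (point-mono i≤i′)
        f∘y : ∀ i → f ((zero ∷ (suc ∘ point)) i) ≡ alternating (j + toℕ i)
        f∘y zero    = trans f₀≡ (cong alternating (sym (+-identityʳ j)))
        f∘y (suc i) = trans (value i) (cong alternating (sym (+-suc j (toℕ i))))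
    ... | yes _ | false = AlternatingChain-suc (hitChain j (suc r) (f ∘ suc) (S ∘ suc) j+r<final)
    ... | no _  | _     = AlternatingChain-suc (hitChain j (suc r) (f ∘ suc) (S ∘ suc) j+r<final)

  alternatingChain⇒violation : ∀ {k n} {f : BoolFun n} → AlternatingChain 0 (suc k) f → Violation k f
  alternatingChain⇒violation {f = f} (chain y y-mono value) =
    y , (λ i → y-mono (<⇒≤ (≤̄⇒inject₁< ≤-refl))) , value zero , alternates
    where
      alternates : ∀ i → f (y (inject₁ i)) ≢ f (y (suc i))
      alternates i eq = not-¬ refl (trans (sym (trans (value (inject₁ i)) (cong alternating (toℕ-inject₁ i))))
                                          (trans eq (value (suc i))))

  module _ (k : ℕ) where
    open Greedy (suc k)

    k<finalState⇒violation : ∀ {n} (f S : BoolFun n) → suc k ≤ finalState 0 f S → Violation k f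
    k<finalState⇒violation f S k<final = alternatingChain⇒violation (hitChain 0 (suc k) f S k<final)

    rounded-kMonotone : ∀ {n} (f S : BoolFun n) → finalState 0 f S < suc k → KMonotone k (rounded 0 f S)
    rounded-kMonotone f S final<K (x , x-mono , starts , alternates) = <⇒≱ final<K (begin
      suc k                         ≡⟨ cong suc (toℕ-fromℕ k) ⟨
      suc (toℕ (fromℕ k))           ≤⟨ index<state (fromℕ k) ⟩
      state (fromℕ k)               ≤⟨ stateAfter≤finalState 0 f S (x (fromℕ k)) ⟩
      finalState 0 f S              ∎)
      where
        open ≤-Reasoning
        state = stateAfter 0 f S ∘ x
        index<state : ∀ i → toℕ i < state i
        index<state = <-weakInduction (λ i → toℕ i < state i) (positive (state zero) starts) next
          where
            positive : ∀ s → not (alternating s) ≡ true → 0 < s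
            positive (suc s) _ = s≤s z≤n
            next : ∀ i → toℕ (inject₁ i) < state (inject₁ i) → suc (toℕ i) < state (suc i)
            next i i<state = ≤-<-trans (subst (_< state (inject₁ i)) (toℕ-inject₁ i) i<state)
              (≤∧≢⇒< (stateAfter-mono 0 f S (x-mono i)) (alternates i ∘ cong (not ∘ alternating)))

    failure⇒misses : ∀ {n} a b (f S : BoolFun n) → (∀ g → KMonotone k g → a ≤ b * hamming f g) →
      a * 𝟙 (does (finalState 0 f S <? suc k)) ≤ b * misses 0 f S
    failure⇒misses a b f S far with does (finalState 0 f S <? suc k) | proof (finalState 0 f S <? suc k)
    ... | false | _           = subst (_≤ b * misses 0 f S) (sym (*-zeroʳ a)) z≤n
    ... | true  | ofʸ final<K = begin
      a * 1                          ≡⟨ *-identityʳ a ⟩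
      a                              ≤⟨ far (rounded 0 f S) (rounded-kMonotone f S final<K) ⟩
      b * hamming f (rounded 0 f S)  ≤⟨ *-monoʳ-≤ b (hamming-rounded≤misses 0 f S final<K) ⟩
      b * misses 0 f S               ∎
      where open ≤-Reasoning

  sum-mono-≤ : ∀ {m} {g h : Fin m → ℕ} → (∀ i → g i ≤ h i) → sum g ≤ sum h
  sum-mono-≤ {zero}  g≤h = z≤n
  sum-mono-≤ {suc m} g≤h = +-mono-≤ (g≤h zero) (sum-mono-≤ (g≤h ∘ suc))

  sum-const : ∀ m c → ∑[ i < m ] c ≡ m * c
  sum-const zero    c = refl
  sum-const (suc m) c = cong (c +_) (sum-const m c)

  sum-↑ : ∀ m {n} (g : Fin (m + n) → ℕ) → sum g ≡ sum (g ∘ (_↑ˡ n)) + sum (g ∘ (m ↑ʳ_))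
  sum-↑ zero    g = refl
  sum-↑ (suc m) g = trans (cong (g zero +_) (sum-↑ m (g ∘ suc))) (sym (+-assoc (g zero) _ _))

  sum-combine : ∀ m {n} (g : Fin (m * n) → ℕ) → sum g ≡ ∑[ i < m ] sum (g ∘ combine i)
  sum-combine zero    g = refl
  sum-combine (suc m) {n} g = trans (sum-↑ n g) (cong (sum (g ∘ (_↑ˡ m * n)) +_) (sum-combine m (g ∘ (n ↑ʳ_))))

  count≡∑𝟙 : ∀ {m} (p : Fin m → Bool) → count p ≡ sum (𝟙 ∘ p)
  count≡∑𝟙 {zero}  p = refl
  count≡∑𝟙 {suc m} p = trans (count-suc p) (cong (𝟙 (p zero) +_) (count≡∑𝟙 (p ∘ suc)))

  balance-active : ∀ P E X {M₁ M₀ H₁ H₀} → P * M₁ ≡ E * H₁ → P * M₀ ≡ E * H₀ →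
    P * (P * M₁ + E * (X + M₀)) ≡ E * (P * (X + H₁) + E * H₀)
  balance-active P E X {M₁} {M₀} {H₁} {H₀} eq₁ eq₀ = begin
    P * (P * M₁ + E * (X + M₀))               ≡⟨ expand P E X M₁ M₀ ⟩
    P * (P * M₁) + E * (P * M₀) + P * (E * X) ≡⟨ cong₂ (λ a b → P * a + E * b + P * (E * X)) eq₁ eq₀ ⟩
    P * (E * H₁) + E * (E * H₀) + P * (E * X) ≡⟨ collect P E X H₁ H₀ ⟩
    E * (P * (X + H₁) + E * H₀)               ∎
    where
      open ≡-Reasoning
      expand : ∀ P E X M₁ M₀ → P * (P * M₁ + E * (X + M₀)) ≡ P * (P * M₁) + E * (P * M₀) + P * (E * X)
      expand = solve-∀
      collect : ∀ P E X H₁ H₀ → P * (E * H₁) + E * (E * H₀) + P * (E * X) ≡ E * (P * (X + H₁) + E * H₀)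
      collect = solve-∀

  balance-inactive : ∀ P E {M H} → P * M ≡ E * H → P * (P * M + E * M) ≡ E * (P * H + E * H)
  balance-inactive P E {M} {H} eq = begin
    P * (P * M + E * M) ≡⟨ factorˡ P E M ⟩
    (P + E) * (P * M)   ≡⟨ cong ((P + E) *_) eq ⟩
    (P + E) * (E * H)   ≡⟨ factorʳ P E H ⟨
    E * (P * H + E * H) ∎
    where
      open ≡-Reasoning
      factorˡ : ∀ P E M → P * (P * M + E * M) ≡ (P + E) * (P * M)
      factorˡ = solve-∀
      factorʳ : ∀ P E H → E * (P * H + E * H) ≡ (P + E) * (E * H)
      factorʳ = solve-∀

  module Sampling (P E : ℕ) where

    D : ℕ
    D = P + E

    Seed : ℕ → Set
    Seed n = Vector (Fin D) n

    selected : ∀ {n} → Seed n → BoolFun n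
    selected σ x = does (toℕ (σ x) <? P)

    -- sumAll n F = D ^ n · 𝔼[F σ] for a uniformly random seed σ.
    sumAll : ∀ n → (Seed n → ℕ) → ℕ
    sumAll zero    F = F []
    sumAll (suc n) F = ∑[ d < D ] sumAll n (λ σ → F (d ∷ σ))

    sumAll-cong : ∀ n {F G : Seed n → ℕ} → (∀ σ → F σ ≡ G σ) → sumAll n F ≡ sumAll n G
    sumAll-cong zero    F≡G = F≡G []
    sumAll-cong (suc n) F≡G = sum-cong-≗ {D} (λ d → sumAll-cong n (λ σ → F≡G (d ∷ σ)))

    sumAll-mono-≤ : ∀ n {F G : Seed n → ℕ} → (∀ σ → F σ ≤ G σ) → sumAll n F ≤ sumAll n G
    sumAll-mono-≤ zero    F≤G = F≤G []
    sumAll-mono-≤ (suc n) F≤G = sum-mono-≤ (λ d → sumAll-mono-≤ n (λ σ → F≤G (d ∷ σ)))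

    sumAll-+ : ∀ n (F G : Seed n → ℕ) → sumAll n (λ σ → F σ + G σ) ≡ sumAll n F + sumAll n G
    sumAll-+ zero    F G = refl
    sumAll-+ (suc n) F G = trans (sum-cong-≗ {D} (λ d → sumAll-+ n _ _)) (∑-distrib-+ {D} _ _)

    *-distribˡ-sumAll : ∀ n c (F : Seed n → ℕ) → c * sumAll n F ≡ sumAll n (λ σ → c * F σ)
    *-distribˡ-sumAll zero    c F = refl
    *-distribˡ-sumAll (suc n) c F = trans (*-distribˡ-sum {D} c _) (sum-cong-≗ {D} (λ d → *-distribˡ-sumAll n c _))

    sumAll-const : ∀ n c → sumAll n (λ _ → c) ≡ c * D ^ n
    sumAll-const zero    c = sym (*-identityʳ c)
    sumAll-const (suc n) c = begin
      ∑[ d < D ] sumAll n (λ _ → c) ≡⟨ sum-cong-≗ {D} (λ d → sumAll-const n c) ⟩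
      ∑[ d < D ] (c * D ^ n)        ≡⟨ sum-const D (c * D ^ n) ⟩
      D * (c * D ^ n)               ≡⟨ *-comm D (c * D ^ n) ⟩
      c * D ^ n * D                 ≡⟨ *-assoc c (D ^ n) D ⟩
      c * (D ^ n * D)               ≡⟨ cong (c *_) (*-comm (D ^ n) D) ⟩
      c * D ^ suc n                 ∎
      where open ≡-Reasoning

    sumAll-1+ : ∀ n (F : Seed n → ℕ) → sumAll n (λ σ → 1 + F σ) ≡ D ^ n + sumAll n F
    sumAll-1+ n F = trans (sumAll-+ n (λ _ → 1) F) (cong (_+ sumAll n F) (trans (sumAll-const n 1) (*-identityˡ _)))

    sum-selection : ∀ (G : Bool → ℕ) → ∑[ d < D ] G (does (toℕ d <? P)) ≡ P * G true + E * G false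
    sum-selection G = go P
      where
        go : ∀ P′ → ∑[ d < P′ + E ] G (does (toℕ d <? P′)) ≡ P′ * G true + E * G false
        go zero     = sum-const E (G false)
        go (suc P′) = trans (cong (G true +_) (go P′)) (sym (+-assoc (G true) _ _))

    decodeSeed : ∀ {n} → Fin (D ^ n) → Seed n
    decodeSeed {zero}  s = []
    decodeSeed {suc n} s = proj₁ (remQuot {D} (D ^ n) s) ∷ decodeSeed (proj₂ (remQuot {D} (D ^ n) s))

    decodeSeed-combine : ∀ {n} d s → decodeSeed {suc n} (combine d s) ≡ d ∷ decodeSeed s
    decodeSeed-combine {n} d s = cong (λ (d , s) → d ∷ decodeSeed s) (remQuot-combine {D} {D ^ n} d s)

    sum-decodeSeed : ∀ n (F : Seed n → ℕ) → sum (F ∘ decodeSeed {n}) ≡ sumAll n F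
    sum-decodeSeed zero    F = +-identityʳ (F [])
    sum-decodeSeed (suc n) F = begin
      sum (F ∘ decodeSeed)                        ≡⟨ sum-combine D (F ∘ decodeSeed) ⟩
      ∑[ d < D ] sum (F ∘ decodeSeed ∘ combine d) ≡⟨ sum-cong-≗ {D} (λ d → sum-cong-≗ {D ^ n} (cong F ∘ decodeSeed-combine d)) ⟩
      ∑[ d < D ] sum (λ s → F (d ∷ decodeSeed s)) ≡⟨ sum-cong-≗ {D} (λ d → sum-decodeSeed n (λ σ → F (d ∷ σ))) ⟩
      sumAll (suc n) F                            ∎
      where open ≡-Reasoning

    D*sumAll-count≡n*P*Dⁿ : ∀ n → D * sumAll n (count ∘ selected) ≡ n * (P * D ^ n)
    D*sumAll-count≡n*P*Dⁿ zero    = *-zeroʳ D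
    D*sumAll-count≡n*P*Dⁿ (suc n) = begin
      D * sumAll (suc n) (count ∘ selected)   ≡⟨ cong (D *_) (sum-cong-≗ {D} (λ d → sumAll-cong n (count-cons d))) ⟩
      D * ∑[ d < D ] Size (does (toℕ d <? P)) ≡⟨ cong (D *_) (sum-selection Size) ⟩
      D * (P * Size true + E * C)             ≡⟨ cong (λ x → D * (P * x + E * C)) (sumAll-1+ n (count ∘ selected)) ⟩
      D * (P * (D ^ n + C) + E * C)           ≡⟨ cong (D *_) (regroup P E (D ^ n) C) ⟩
      D * (P * D ^ n + D * C)                 ≡⟨ cong (λ x → D * (P * D ^ n + x)) (D*sumAll-count≡n*P*Dⁿ n) ⟩
      D * (P * D ^ n + n * (P * D ^ n))       ≡⟨ collect D P (D ^ n) n ⟩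
      suc n * (P * D ^ suc n)                 ∎
      where
        open ≡-Reasoning
        count-cons : ∀ d σ → count (selected (d ∷ σ)) ≡ 𝟙 (does (toℕ d <? P)) + count (selected σ)
        count-cons d σ = count-suc (selected (d ∷ σ))
        C = sumAll n (count ∘ selected)
        Size : Bool → ℕ
        Size s = sumAll n (λ σ → 𝟙 s + count (selected σ))
        regroup : ∀ P E X C → P * (X + C) + E * C ≡ P * X + (P + E) * C
        regroup = solve-∀
        collect : ∀ D P X n → D * (P * X + n * (P * X)) ≡ suc n * (P * (D * X))
        collect = solve-∀

    count-decodeSeed : ∀ n (p : Seed n → Bool) → count (p ∘ decodeSeed {n}) ≡ sumAll n (𝟙 ∘ p)
    count-decodeSeed n p = trans (count≡∑𝟙 (p ∘ decodeSeed)) (sum-decodeSeed n (𝟙 ∘ p))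

    oversized : ∀ {n} → ℕ → Seed n → Bool
    oversized q σ = does (q <? count (selected σ))

    overflows : ∀ n → ℕ → ℕ
    overflows n q = sumAll n (𝟙 ∘ oversized q)

    markov : ∀ n t (F : Seed n → ℕ) → suc t * sumAll n (λ σ → 𝟙 (does (t <? F σ))) ≤ sumAll n F
    markov n t F = ≤-trans (≤-reflexive (*-distribˡ-sumAll n (suc t) _)) (sumAll-mono-≤ n pointwise)
      where
        pointwise : ∀ σ → suc t * 𝟙 (does (t <? F σ)) ≤ F σ
        pointwise σ with does (t <? F σ) | proof (t <? F σ)
        ... | true  | ofʸ t<F = subst (_≤ F σ) (sym (*-identityʳ (suc t))) t<F
        ... | false | _       = subst (_≤ F σ) (sym (*-zeroʳ (suc t))) z≤n

    module _ (K : ℕ) where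
      open Greedy K

      -- Whether the first point is selected is decided by σ zero alone: if the point is active,
      -- it is a hit for P of the D values of σ zero and a miss for the other E.
      P*misses≡E*hits : ∀ n j (f : BoolFun n) →
        P * sumAll n (misses j f ∘ selected) ≡ E * sumAll n (hits j f ∘ selected)
      P*misses≡E*hits zero    j f = trans (*-zeroʳ P) (sym (*-zeroʳ E))
      P*misses≡E*hits (suc n) j f = begin
        P * sumAll (suc n) (misses j f ∘ selected) ≡⟨ cong (P *_) (sum-selection Miss) ⟩
        P * (P * Miss true + E * Miss false)       ≡⟨ by-activity ⟩
        E * (P * Hit true + E * Hit false)         ≡⟨ cong (E *_) (sum-selection Hit) ⟨
        E * sumAll (suc n) (hits j f ∘ selected)   ∎
        where
          open ≡-Reasoning
          Miss Hit : Bool → ℕ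
          Miss s = sumAll n (λ σ →
            𝟙 (does (active? j (f zero)) ∧ not s) + misses (step j (f zero) s) (f ∘ suc) (selected σ))
          Hit  s = sumAll n (λ σ →
            𝟙 (does (active? j (f zero)) ∧ s) + hits (step j (f zero) s) (f ∘ suc) (selected σ))
          by-activity : P * (P * Miss true + E * Miss false) ≡ E * (P * Hit true + E * Hit false)
          by-activity with active? j (f zero)
          ... | yes _
            rewrite sumAll-1+ n (misses j (f ∘ suc) ∘ selected) | sumAll-1+ n (hits (suc j) (f ∘ suc) ∘ selected) =
            balance-active P E (D ^ n) (P*misses≡E*hits n (suc j) (f ∘ suc)) (P*misses≡E*hits n j (f ∘ suc))
          ... | no _ = balance-inactive P E (P*misses≡E*hits n j (f ∘ suc))

    module _ (k : ℕ) where
      open Greedy (suc k)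

      scanFails : ∀ {n} → BoolFun n → Seed n → Bool
      scanFails f σ = does (finalState 0 f (selected σ) <? suc k)

      failures : ∀ n → BoolFun n → ℕ
      failures n f = sumAll n (𝟙 ∘ scanFails f)

      failure-bound : ∀ n a b (f : BoolFun n) → (∀ g → KMonotone k g → a ≤ b * hamming f g) →
        P * (a * failures n f) ≤ b * (E * (suc k * D ^ n))
      failure-bound n a b f far = begin
        P * (a * failures n f)                           ≡⟨ cong (P *_) (*-distribˡ-sumAll n a _) ⟩
        P * sumAll n (λ σ → a * 𝟙 (scanFails f σ))       ≤⟨ *-monoʳ-≤ P (sumAll-mono-≤ n few-misses) ⟩
        P * sumAll n (λ σ → b * misses 0 f (selected σ)) ≡⟨ cong (P *_) (*-distribˡ-sumAll n b _) ⟨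
        P * (b * sumAll n (misses 0 f ∘ selected))       ≡⟨ x∙yz≈y∙xz P b _ ⟩
        b * (P * sumAll n (misses 0 f ∘ selected))       ≡⟨ cong (b *_) (P*misses≡E*hits (suc k) n 0 f) ⟩
        b * (E * sumAll n (hits 0 f ∘ selected))         ≤⟨ *-monoʳ-≤ b (*-monoʳ-≤ E hits≤K·Dⁿ) ⟩
        b * (E * (suc k * D ^ n))                        ∎
        where
          open ≤-Reasoning
          few-misses : ∀ σ → a * 𝟙 (scanFails f σ) ≤ b * misses 0 f (selected σ)
          few-misses σ = failure⇒misses k a b f (selected σ) far
          hits≤K·Dⁿ : sumAll n (hits 0 f ∘ selected) ≤ suc k * D ^ n
          hits≤K·Dⁿ = ≤-trans (sumAll-mono-≤ n (λ σ → hits≤ 0 f (selected σ)))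
                              (≤-reflexive (sumAll-const n (suc k)))

  rank : ∀ {n} → BoolFun n → Fin n → ℕ
  rank S zero    = 0
  rank S (suc x) = 𝟙 (S zero) + rank (S ∘ suc) x

  select : ∀ {n} → BoolFun n → ℕ → Maybe (Fin n)
  select {zero}  S j       = nothing
  select {suc n} S j with S zero | j
  ... | true  | zero  = just zero
  ... | true  | suc i = Maybe.map suc (select (S ∘ suc) i)
  ... | false | _     = Maybe.map suc (select (S ∘ suc) j)

  select-rank : ∀ {n} (S : BoolFun n) {x} → S x ≡ true → select S (rank S x) ≡ just x
  select-rank S {zero}  Sx rewrite Sx = refl
  select-rank S {suc x} Sx with S zero
  ... | true  rewrite select-rank (S ∘ suc) Sx = refl
  ... | false rewrite select-rank (S ∘ suc) Sx = refl

  rank<count : ∀ {n} (S : BoolFun n) {x} → S x ≡ true → rank S x < count S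
  rank<count S {zero}  Sx rewrite count-suc S | Sx = s≤s z≤n
  rank<count S {suc x} Sx rewrite count-suc S = +-monoʳ-< (𝟙 (S zero)) (rank<count (S ∘ suc) Sx)

  module Tester (k P E q n′ : ℕ) where
    open Greedy (suc k)
    open Sampling P E

    n : ℕ
    n = suc n′

    -- The j-th query is the j-th selected point; queries beyond the sample go to point zero.
    queryAt : Seed n → Fin q → Fin n
    queryAt σ j = fromMaybe zero (select (selected σ) (toℕ j))

    recover : Seed n → (Fin q → Bool) → BoolFun n
    recover σ answer x with rank (selected σ) x <? q
    ... | yes r<q = answer (fromℕ< r<q)
    ... | no  _   = false

    verdict : Seed n → (Fin q → Bool) → Bool
    verdict σ answer with count (selected σ) ≤? q
    ... | yes _ = does (finalState 0 (recover σ answer) (selected σ) <? suc k)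
    ... | no  _ = true

    recover-selected : ∀ f σ → count (selected σ) ≤ q →
      ∀ x → selected σ x ≡ true → recover σ (f ∘ queryAt σ) x ≡ f x
    recover-selected f σ size≤q x x∈S with rank (selected σ) x <? q
    ... | yes r<q rewrite toℕ-fromℕ< r<q | select-rank (selected σ) x∈S = refl
    ... | no  r≮q = contradiction (<-≤-trans (rank<count (selected σ) x∈S) size≤q) r≮q

    finalState-recover : ∀ f σ → count (selected σ) ≤ q →
      finalState 0 (recover σ (f ∘ queryAt σ)) (selected σ) ≡ finalState 0 f (selected σ)
    finalState-recover f σ size≤q = finalState-cong 0 (selected σ) (recover-selected f σ size≤q)

    accepts-kMonotone : ∀ f → KMonotone k f → ∀ σ → verdict σ (f ∘ queryAt σ) ≡ true
    accepts-kMonotone f f-mono σ with count (selected σ) ≤? q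
    ... | no  _      = refl
    ... | yes size≤q rewrite finalState-recover f σ size≤q =
      dec-true (finalState 0 f (selected σ) <? suc k) (≰⇒> (f-mono ∘ k<finalState⇒violation k f (selected σ)))

    accepts⇒ : ∀ f σ → verdict σ (f ∘ queryAt σ) ≡ true →
      finalState 0 f (selected σ) < suc k ⊎ q < count (selected σ)
    accepts⇒ f σ accept with count (selected σ) ≤? q
    ... | no  size≰q = inj₂ (≰⇒> size≰q)
    ... | yes size≤q rewrite finalState-recover f σ size≤q
      with does (finalState 0 f (selected σ) <? suc k) | proof (finalState 0 f (selected σ) <? suc k)
    ...   | true | ofʸ final<K = inj₁ final<K

    tester : .{{_ : ℕ.NonZero D}} → NATester n q
    tester = record
      { seeds   = D ^ n
      ; seeds>0 = m^n>0 D n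
      ; query   = queryAt ∘ decodeSeed
      ; decide  = verdict ∘ decodeSeed
      }

    acceptances : BoolFun n → ℕ
    acceptances f = sumAll n (λ σ → 𝟙 (verdict σ (f ∘ queryAt σ)))

    accepts≡acceptances : .{{_ : ℕ.NonZero D}} → ∀ f → accepts tester f ≡ acceptances f
    accepts≡acceptances f = count-decodeSeed n (λ σ → verdict σ (f ∘ queryAt σ))

    acceptances≤ : ∀ f → acceptances f ≤ failures k n f + overflows n q
    acceptances≤ f = ≤-trans
      (sumAll-mono-≤ n (λ σ →
        𝟙≤𝟙+𝟙 _ (finalState 0 f (selected σ) <? suc k) (q <? count (selected σ)) (accepts⇒ f σ)))
      (≤-reflexive (sumAll-+ n (𝟙 ∘ scanFails k f) (𝟙 ∘ oversized q)))

    acceptances-kMonotone : ∀ f → KMonotone k f → acceptances f ≡ D ^ n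
    acceptances-kMonotone f f-mono = begin
      acceptances f          ≡⟨ sumAll-cong n (cong 𝟙 ∘ accepts-kMonotone f f-mono) ⟩
      sumAll n (λ _ → 1)     ≡⟨ sumAll-const n 1 ⟩
      1 * D ^ n              ≡⟨ *-identityˡ (D ^ n) ⟩
      D ^ n                  ∎
      where open ≡-Reasoning

  sum-of-sixths : ∀ {x y z s} → x ≤ y + z → 6 * y ≤ s → 6 * z ≤ s → 3 * x ≤ s
  sum-of-sixths {x} {y} {z} {s} x≤y+z 6y≤s 6z≤s = *-cancelˡ-≤ 2 (begin
    2 * (3 * x)   ≡⟨ *-assoc 2 3 x ⟨
    6 * x         ≤⟨ *-monoʳ-≤ 6 x≤y+z ⟩
    6 * (y + z)   ≡⟨ *-distribˡ-+ 6 y z ⟩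
    6 * y + 6 * z ≤⟨ +-mono-≤ 6y≤s 6z≤s ⟩
    s + s         ≡⟨ cong (s +_) (+-identityʳ s) ⟨
    2 * s         ∎)
    where open ≤-Reasoning

  module _ (k a′ b′ q n′ : ℕ) where
    private
      a b P E : ℕ
      a = suc a′
      b = suc b′
      P = 6 * (suc k * b)
      E = a * suc n′
    open Sampling P E
    open Tester k P E q n′

    rejects-far : 6 * P ≤ a * suc q → ∀ f → (∀ g → KMonotone k g → a * n ≤ b * hamming f g) →
      3 * acceptances f ≤ D ^ n
    rejects-far 6P≤a[1+q] f far =
      sum-of-sixths {y = failures k n f} {z = overflows n q} (acceptances≤ f) few-failures few-overflows
      where
        open ≤-Reasoning
        few-failures : 6 * failures k n f ≤ D ^ n
        few-failures = *-cancelˡ-≤ (suc k * b * E) (begin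
          suc k * b * E * (6 * failures k n f) ≡⟨ regroup (suc k) b E (failures k n f) ⟩
          P * (E * failures k n f)             ≤⟨ failure-bound k n E b f far ⟩
          b * (E * (suc k * D ^ n))            ≡⟨ collect (suc k) b E (D ^ n) ⟩
          suc k * b * E * D ^ n                ∎)
          where
            regroup : ∀ K b E F → K * b * E * (6 * F) ≡ 6 * (K * b) * (E * F)
            regroup = solve-∀
            collect : ∀ K b E X → b * (E * (K * X)) ≡ K * b * E * X
            collect = solve-∀
        few-overflows : 6 * overflows n q ≤ D ^ n
        few-overflows = *-cancelˡ-≤ (n * P) (begin
          n * P * (6 * overflows n q)      ≡⟨ regroup n P (overflows n q) ⟩
          n * (6 * P) * overflows n q      ≤⟨ *-monoˡ-≤ (overflows n q) (*-monoʳ-≤ n 6P≤a[1+q]) ⟩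
          n * (a * suc q) * overflows n q  ≡⟨ collect n a (suc q) (overflows n q) ⟩
          E * (suc q * overflows n q)      ≤⟨ *-mono-≤ (m≤n+m E P) (markov n q (count ∘ selected)) ⟩
          D * sumAll n (count ∘ selected)  ≡⟨ D*sumAll-count≡n*P*Dⁿ n ⟩
          n * (P * D ^ n)                  ≡⟨ *-assoc n P (D ^ n) ⟨
          n * P * D ^ n                    ∎)
          where
            regroup : ∀ n P O → n * P * (6 * O) ≡ n * (6 * P) * O
            regroup = solve-∀
            collect : ∀ n a q O → n * (a * q) * O ≡ a * n * (q * O)
            collect = solve-∀

  module _ (a b′ : ℕ) .(coprime : Coprime a (suc b′)) where
    private
      ε : ℚ
      ε = mkℚ (ℤ.+ a) b′ coprime

    toℚᵘ-ℕ→ℚ : ∀ m → toℚᵘ (ℕ→ℚ m) ℚᵘ.≃ mkℚᵘ (ℤ.+ m) 0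
    toℚᵘ-ℕ→ℚ m = toℚᵘ-fromℚᵘ (mkℚᵘ (ℤ.+ m) 0)

    toℚᵘ-ℕ→ℚ*ε : ∀ m → toℚᵘ (ℕ→ℚ m ℚ.* ε) ℚᵘ.≃ mkℚᵘ (ℤ.+ m) 0 ℚᵘ.* mkℚᵘ (ℤ.+ a) b′
    toℚᵘ-ℕ→ℚ*ε m = ℚᵘ.≃-trans (toℚᵘ-homo-* (ℕ→ℚ m) ε) (ℚᵘ.*-cong (toℚᵘ-ℕ→ℚ m) ℚᵘ.≃-refl)

    mkℚᵘ*≤mkℚᵘ⇔ : ∀ m h →
      (mkℚᵘ (ℤ.+ m) 0 ℚᵘ.* mkℚᵘ (ℤ.+ a) b′ ℚᵘ.≤ mkℚᵘ (ℤ.+ h) 0) ⇔ (m * a ≤ h * suc b′)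
    mkℚᵘ*≤mkℚᵘ⇔ m h = mk⇔ (λ { (ℚᵘ.*≤* p) → ℤ.drop‿+≤+ (subst₂ ℤ._≤_ lhs rhs p) })
                     (λ le → ℚᵘ.*≤* (subst₂ ℤ._≤_ (sym lhs) (sym rhs) (ℤ.+≤+ le)))
      where
        lhs = trans (ℤ.*-identityʳ _) (sym (ℤ.pos-* m a))
        rhs = trans (sym (ℤ.pos-* h _)) (cong (λ x → ℤ.+ (h * suc x)) (+-identityʳ b′))

    ℕ→ℚ*ε≤ℕ→ℚ⇔ : ∀ m h → (ℕ→ℚ m ℚ.* ε ℚ.≤ ℕ→ℚ h) ⇔ (m * a ≤ h * suc b′)
    ℕ→ℚ*ε≤ℕ→ℚ⇔ m h = mk⇔
      (λ le → Equivalence.to (mkℚᵘ*≤mkℚᵘ⇔ m h)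
        (ℚᵘ.≤-respʳ-≃ (toℚᵘ-ℕ→ℚ h) (ℚᵘ.≤-respˡ-≃ (toℚᵘ-ℕ→ℚ*ε m) (toℚᵘ-mono-≤ le))))
      (λ le → toℚᵘ-cancel-≤ (ℚᵘ.≤-respʳ-≃ (ℚᵘ.≃-sym (toℚᵘ-ℕ→ℚ h))
        (ℚᵘ.≤-respˡ-≃ (ℚᵘ.≃-sym (toℚᵘ-ℕ→ℚ*ε m)) (Equivalence.from (mkℚᵘ*≤mkℚᵘ⇔ m h) le))))

  m<n*[1+m/n] : ∀ m n .{{_ : ℕ.NonZero n}} → m < n * suc (m / n)
  m<n*[1+m/n] m n = begin-strict
    m                 ≡⟨ m≡m%n+[m/n]*n m n ⟩
    m % n + m / n * n <⟨ +-monoˡ-< (m / n * n) (m%n<n m n) ⟩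
    n + m / n * n     ≡⟨ cong (n +_) (*-comm (m / n) n) ⟩
    n + n * (m / n)   ≡⟨ *-suc n (m / n) ⟨
    n * suc (m / n)   ∎
    where open ≤-Reasoning

  oneSidedTester : (n k : ℕ) → 1 ≤ n → 1 ≤ k → (ε : ℚ) → 0ℚ ℚ.< ε →
    Σ ℕ λ q → (ℕ→ℚ q ℚ.* ε ℚ.≤ ℕ→ℚ (72 * k)) × Σ (NATester n q) λ T → OneSidedKMonoTester k n q ε T
  oneSidedTester (suc n′) k _ 1≤k ε@(mkℚ (ℤ.+ suc a′) b′ coprime) _ = q , q*ε≤72k , tester , complete , sound
    where
      a b P E q : ℕ
      a = suc a′
      b = suc b′
      P = 6 * (suc k * b)
      E = a * suc n′
      q = 6 * P / a
      open Sampling P E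
      open Tester k P E q n′

      6P≤a[1+q] : 6 * P ≤ a * suc q
      6P≤a[1+q] = <⇒≤ (m<n*[1+m/n] (6 * P) a)

      q*a≤72k*b : q * a ≤ 72 * k * b
      q*a≤72k*b = begin
        q * a                 ≤⟨ m/n*n≤m (6 * P) a ⟩
        6 * P                 ≡⟨ *-assoc 6 6 (suc k * b) ⟨
        36 * (suc k * b)      ≤⟨ *-monoʳ-≤ 36 (*-monoˡ-≤ b (+-monoˡ-≤ k 1≤k)) ⟩
        36 * ((k + k) * b)    ≡⟨ double 36 k b ⟩
        72 * k * b            ∎
        where
          open ≤-Reasoning
          double : ∀ c k b → c * ((k + k) * b) ≡ 2 * c * k * b
          double = solve-∀

      q*ε≤72k : ℕ→ℚ q ℚ.* ε ℚ.≤ ℕ→ℚ (72 * k)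
      q*ε≤72k = Equivalence.from (ℕ→ℚ*ε≤ℕ→ℚ⇔ a b′ coprime q (72 * k)) q*a≤72k*b

      complete : ∀ f → KMonotone k f → accepts tester f ≡ D ^ n
      complete f f-mono = trans (accepts≡acceptances f) (acceptances-kMonotone f f-mono)

      sound : ∀ f → Far k ε f → 3 * accepts tester f ≤ D ^ n
      sound f far =
        subst (λ x → 3 * x ≤ D ^ n) (sym (accepts≡acceptances f)) (rejects-far k a′ b′ q n′ 6P≤a[1+q] f far′)
        where
          far′ : ∀ g → KMonotone k g → a * n ≤ b * hamming f g
          far′ g g-mono = subst₂ _≤_ (*-comm n a) (*-comm (hamming f g) b)
            (Equivalence.to (ℕ→ℚ*ε≤ℕ→ℚ⇔ a b′ coprime n (hamming f g))
              (subst (ℚ._≤ _) (ℚ.*-comm ε (ℕ→ℚ n)) (far g g-mono)))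
  oneSidedTester _ _ _ _ (mkℚ (ℤ.+ zero) _ _) (ℚ.*<* (ℤ.+<+ ()))
  oneSidedTester _ _ _ _ (mkℚ ℤ.-[1+ _ ] _ _) (ℚ.*<* ())

open import Data.Nat using (ℕ; _≤_)
open import Data.Nat using () renaming (_*_ to _*ℕ_)
open import Data.Product using (Σ; _×_; _,_)
open import Data.Rational using (ℚ; 0ℚ; _<_; _*_)
open import Data.Rational using () renaming (_≤_ to _≤ℚ_)

theorem1p4 : Σ ℕ λ C → (n k : ℕ) → 1 ≤ n → 1 ≤ k → (ε : ℚ) → 0ℚ < ε →
    Σ ℕ λ q → (ℕ→ℚ q * ε ≤ℚ ℕ→ℚ (C *ℕ k)) × Σ (NATester n q) λ T → OneSidedKMonoTester k n q ε T
theorem1p4 = 72 , KMonotonicityTesting.oneSidedTester
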